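{- Let $G$ be a finite unicyclic graph with cycle $x_1x_2x_3x_4x_5x_1$ such that $\deg(x_1)\geqslant 3$ and $\deg(x_2)\geqslant 3$. If $G$ has an inner node $u$ lying in the connected component of $G-\{x_2,x_3,x_4,x_5\}$ containing $x_1$, with $d(u,x_1)=3k+1$ or $d(u,x_1)=3k+2$ for some integer $k\geqslant 0$, then $D_3(G)$ is connected.
   Context: A unicyclic graph is a connected graph containing exactly one cycle. The $3$-distance graph $D_3(G)$ has vertex set $V(G)$, two vertices being adjacent iff their distance in $G$ is exactly $3$. A vertex $u$ of $G$ is an inner node if $\deg(u)\geqslant 3$ and $u$ has at least two neighbours of degree at least $2$. -}

module Defs where

open import Data.Nat using (ℕ; zero; suc; _+_; _*_; _≤_; _<_; _≥_)
open import Data.Fin using (Fin; zero; suc; inject₁; fromℕ)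
open import Data.Bool using (Bool; true; false; if_then_else_)
open import Data.List using (List; map; allFin)
open import Data.Nat.ListAction using (sum)
open import Data.Product using (Σ; ∃; ∃-syntax; _×_; _,_)
open import Data.Sum using (_⊎_)
open import Relation.Nullary using (¬_)
open import Relation.Binary.PropositionalEquality using (_≡_; _≢_)
open import Relation.Binary.Construct.Closure.ReflexiveTransitive using (Star)
open import Function.Definitions using (Injective)

record SimpleGraph (n : ℕ) : Set where
  field
    adj   : Fin n → Fin n → Bool
    sym   : ∀ u v → adj u v ≡ adj v u
    irrefl : ∀ v → adj v v ≡ false

module _ {n : ℕ} (G : SimpleGraph n) where
  open SimpleGraph G

  Adj : Fin n → Fin n → Set
  Adj u v = adj u v ≡ true

  deg : Fin n → ℕ
  deg v = sum (map (λ w → if adj v w then 1 else 0) (allFin n))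

  record Walk (u v : Fin n) (k : ℕ) : Set where
    field
      p     : Fin (suc k) → Fin n
      start : p zero ≡ u
      end   : p (fromℕ k) ≡ v
      step  : ∀ (i : Fin k) → Adj (p (inject₁ i)) (p (suc i))

  Dist : Fin n → Fin n → ℕ → Set
  Dist u v d = Walk u v d × (∀ m → m < d → ¬ Walk u v m)

  Connected : Set
  Connected = ∀ u v → ∃[ k ] Walk u v k

  -- a cycle c 0, c 1, ..., c m, c 0 of length m+1 ≥ 3 with distinct vertices
  record Cycle (m : ℕ) : Set where
    field
      c     : Fin (suc m) → Fin n
      inj   : Injective _≡_ _≡_ c
      long  : 2 ≤ m
      step  : ∀ (i : Fin m) → Adj (c (inject₁ i)) (c (suc i))
      close : Adj (c (fromℕ m)) (c zero)

  SameEdge : Fin n → Fin n → Fin n → Fin n → Set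
  SameEdge x y a b = (x ≡ a × y ≡ b) ⊎ (x ≡ b × y ≡ a)

  CycleEdge : ∀ {m} → Cycle m → Fin n → Fin n → Set
  CycleEdge {m} C a b =
    (∃[ i ] SameEdge (Cycle.c C (inject₁ i)) (Cycle.c C (suc i)) a b)
    ⊎ SameEdge (Cycle.c C (fromℕ m)) (Cycle.c C zero) a b

  -- two cycles are the same cycle (subgraph) iff they have the same edge set
  SameCycle : ∀ {m m'} → Cycle m → Cycle m' → Set
  SameCycle C C' = ∀ a b → (CycleEdge C a b → CycleEdge C' a b) × (CycleEdge C' a b → CycleEdge C a b)

  Unicyclic : Set
  Unicyclic = Connected × (∃[ m ] Cycle m)
              × (∀ m m' (C : Cycle m) (C' : Cycle m') → SameCycle C C')

  InnerNode : Fin n → Set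
  InnerNode u = 3 ≤ deg u × (∃[ w₁ ] ∃[ w₂ ] (w₁ ≢ w₂ × Adj u w₁ × Adj u w₂ × 2 ≤ deg w₁ × 2 ≤ deg w₂))

  -- u lies in the component of G - S containing x: walk from x to u avoiding S
  InComponentAvoiding : (Fin n → Set) → Fin n → Fin n → Set
  InComponentAvoiding S x u = ∃[ k ] Σ (Walk x u k) (λ W → ∀ i → ¬ S (Walk.p W i))

  D3Adj : Fin n → Fin n → Set
  D3Adj u v = Dist u v 3

  D3Connected : Set
  D3Connected = ∀ u v → Star D3Adj u v

-- Write v ~ w for connectivity in D₃(G). As the pentagon C = x₁x₂x₃x₄x₅ is the only cycle of G,
-- G has no triangles or squares and every pentagon lies on C; hence a path a b d e with a ≠ d,
-- b ≠ e and some vertex off C is a geodesic, i.e. an edge of D₃(G). Walking three steps at a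
-- time along a geodesic to x₁ joins every vertex to x₁, to a neighbour of x₁ or to a vertex at
-- distance 2 from x₁, and explicit 3-paths using C, a branch of x₂ and a branch t₀ of x₁ of
-- degree ≥ 2 (the branch leading to u) join all of the latter to x₃. It remains to show x₁ ~ x₃.
-- Going out of the inner node u along two of its branches and back along a third gives p ~ q
-- for every 2-path u p q with q ≠ u. Take p, q the next two vertices on a geodesic from u to x₁
-- (or p = x₁, q = x₂ if d(u, x₁) = 1): since d(u, x₁) ≢ 0 (mod 3), one of p, q has distance
-- ≡ 0 and the other ≢ 0 (mod 3) to x₁, so p ~ q links x₁ to a vertex already known to be ~ x₃.

module Submission where

open import Defs
open import Data.Nat using (ℕ; zero; suc; _+_; _*_; _≤_; _<_; z≤n; s≤s; _≤?_; _%_; _/_)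
open import Data.Nat.Properties
open import Data.Nat.DivMod using (m≡m%n+[m/n]*n; m%n<n)
open import Data.Nat.Induction using (<-rec)
open import Data.Nat.ListAction using (sum)
open import Algebra.Properties.CommutativeSemigroup +-commutativeSemigroup using (interchange; x∙yz≈y∙xz)
open import Data.Fin using (Fin; zero; suc; inject₁; fromℕ)
open import Data.Fin.Properties using (any?; pigeonhole) renaming (_≟_ to _≟ᶠ_; <⇒≢ to <⇒≢ᶠ)
open import Data.Bool using (true; false; if_then_else_)
open import Data.Bool.Properties using () renaming (_≟_ to _≟ᵇ_)
open import Data.List using (tabulate)
open import Data.List.Properties using (map-tabulate)
open import Data.Vec using (Vec; []; _∷_; lookup)
open import Data.Vec.Relation.Unary.AllPairs using ([]; _∷_)
open import Data.Vec.Relation.Unary.All using ([]; _∷_)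
open import Data.Vec.Relation.Unary.Unique.Propositional using (Unique)
open import Data.Vec.Relation.Unary.Unique.Propositional.Properties using (lookup-injective)
open import Data.Product using (∃; ∃-syntax; _×_; _,_; proj₁; proj₂)
open import Data.Sum using (_⊎_; inj₁; inj₂; [_,_]′)
import Data.Sum as Sum
open import Data.Empty using (⊥)
open import Data.Unit using (⊤; tt)
open import Function using (id; _∘_; case_of_)
open import Relation.Nullary using (¬_; Dec; yes; no; contradiction)
open import Relation.Nullary.Decidable using (_×-dec_; _⊎-dec_; ¬?; map′)
open import Relation.Unary using (Decidable)
open import Relation.Binary.PropositionalEquality
open import Relation.Binary.Construct.Closure.ReflexiveTransitive using (Star; ε; _◅_; _◅◅_)
import Relation.Binary.Construct.Closure.ReflexiveTransitive as Star

δ : ∀ {n} → Fin n → Fin n → ℕ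
δ zero    zero    = 1
δ zero    (suc _) = 0
δ (suc _) zero    = 0
δ (suc x) (suc y) = δ x y

δ-refl : ∀ {n} (x : Fin n) → δ x x ≡ 1
δ-refl zero    = refl
δ-refl (suc x) = δ-refl x

δ-≢ : ∀ {n} {x w : Fin n} → x ≢ w → δ x w ≡ 0
δ-≢ {x = zero}  {zero}  x≢w = contradiction refl x≢w
δ-≢ {x = zero}  {suc _} _   = refl
δ-≢ {x = suc _} {zero}  _   = refl
δ-≢ {x = suc x} {suc w} x≢w = δ-≢ (λ x≡w → x≢w (cong suc x≡w))

∑ : ∀ {n} → (Fin n → ℕ) → ℕ
∑ f = sum (tabulate f)

∑-mono-≤ : ∀ {n} {f g : Fin n → ℕ} → (∀ w → f w ≤ g w) → ∑ f ≤ ∑ g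
∑-mono-≤ {zero}  f≤g = z≤n
∑-mono-≤ {suc n} f≤g = +-mono-≤ (f≤g zero) (∑-mono-≤ (λ w → f≤g (suc w)))

∑-+ : ∀ {n} (f g : Fin n → ℕ) → ∑ (λ w → f w + g w) ≡ ∑ f + ∑ g
∑-+ {zero}  f g = refl
∑-+ {suc n} f g = trans (cong (f zero + g zero +_) (∑-+ (f ∘ suc) (g ∘ suc)))
                        (interchange (f zero) (g zero) (∑ (f ∘ suc)) (∑ (g ∘ suc)))

∑-zero : ∀ n → ∑ {n} (λ _ → 0) ≡ 0
∑-zero zero    = refl
∑-zero (suc n) = ∑-zero n

∑-δ : ∀ {n} (x : Fin n) → ∑ (δ x) ≡ 1
∑-δ {suc n} zero    = cong suc (∑-zero n)
∑-δ {suc n} (suc x) = ∑-δ x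

module Graph {n : ℕ} (G : SimpleGraph n) where

  open SimpleGraph G using (adj)

  Adj? : ∀ u v → Dec (Adj G u v)
  Adj? u v = adj u v ≟ᵇ true

  Adj-sym : ∀ {u v} → Adj G u v → Adj G v u
  Adj-sym {u} {v} uv = trans (SimpleGraph.sym G v u) uv

  Adj⇒≢ : ∀ {u v} → Adj G u v → u ≢ v
  Adj⇒≢ {u} uu refl with trans (sym uu) (SimpleGraph.irrefl G u)
  ... | ()

  deg≡∑ : ∀ v → deg G v ≡ ∑ (λ w → if adj v w then 1 else 0)
  deg≡∑ v = cong sum (map-tabulate id (λ w → if adj v w then 1 else 0))

  deg≤∑ : ∀ {v} (f : Fin n → ℕ) → (∀ w → Adj G v w → 1 ≤ f w) → deg G v ≤ ∑ f
  deg≤∑ {v} f bound = ≤-trans (≤-reflexive (deg≡∑ v)) (∑-mono-≤ pointwise)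
    where
    pointwise : ∀ w → (if adj v w then 1 else 0) ≤ f w
    pointwise w with adj v w in vw
    ... | false = z≤n
    ... | true  = bound w vw

  ≢-neighbours⇒2≤deg : ∀ {v a b} → Adj G v a → Adj G v b → a ≢ b → 2 ≤ deg G v
  ≢-neighbours⇒2≤deg {v} {a} {b} va vb a≢b = begin
    2                                   ≡⟨ cong₂ _+_ (∑-δ a) (∑-δ b) ⟨
    ∑ (δ a) + ∑ (δ b)                   ≡⟨ ∑-+ (δ a) (δ b) ⟨
    ∑ (λ w → δ a w + δ b w)             ≤⟨ ∑-mono-≤ pointwise ⟩
    ∑ (λ w → if adj v w then 1 else 0)  ≡⟨ deg≡∑ v ⟨
    deg G v                             ∎
    where
    open ≤-Reasoning
    pointwise : ∀ w → δ a w + δ b w ≤ (if adj v w then 1 else 0)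
    pointwise w with a ≟ᶠ w | b ≟ᶠ w
    ... | yes refl | _        rewrite δ-refl w | δ-≢ (λ b≡w → a≢b (sym b≡w)) | va = ≤-refl
    ... | no a≢w   | yes refl rewrite δ-≢ a≢w | δ-refl w | vb = ≤-refl
    ... | no a≢w   | no b≢w   rewrite δ-≢ a≢w | δ-≢ b≢w = z≤n

  neighbour-≢ : ∀ {v} → 2 ≤ deg G v → ∀ x → ∃[ w ] Adj G v w × w ≢ x
  neighbour-≢ {v} 2≤deg x with any? (λ w → Adj? v w ×-dec ¬? (w ≟ᶠ x))
  ... | yes found = found
  ... | no none   = contradiction (≤-trans 2≤deg (≤-trans (deg≤∑ (δ x) onlyX) (≤-reflexive (∑-δ x)))) λ { (s≤s ()) }
    where
    onlyX : ∀ w → Adj G v w → 1 ≤ δ x w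
    onlyX w vw with x ≟ᶠ w
    ... | yes refl = ≤-reflexive (sym (δ-refl w))
    ... | no x≢w   = contradiction (w , vw , λ w≡x → x≢w (sym w≡x)) none

  neighbour-≢₂ : ∀ {v} → 3 ≤ deg G v → ∀ x y → ∃[ w ] Adj G v w × w ≢ x × w ≢ y
  neighbour-≢₂ {v} 3≤deg x y with any? (λ w → Adj? v w ×-dec ¬? (w ≟ᶠ x) ×-dec ¬? (w ≟ᶠ y))
  ... | yes found = found
  ... | no none   = contradiction (≤-trans 3≤deg (≤-trans (deg≤∑ _ onlyXY) (≤-reflexive ∑≡2))) λ { (s≤s (s≤s ())) }
    where
    ∑≡2 : ∑ (λ w → δ x w + δ y w) ≡ 2
    ∑≡2 = trans (∑-+ (δ x) (δ y)) (cong₂ _+_ (∑-δ x) (∑-δ y))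
    onlyXY : ∀ w → Adj G v w → 1 ≤ δ x w + δ y w
    onlyXY w vw with x ≟ᶠ w | y ≟ᶠ w
    ... | yes refl | _        = ≤-trans (≤-reflexive (sym (δ-refl w))) (m≤m+n _ _)
    ... | no _     | yes refl = ≤-trans (≤-reflexive (sym (δ-refl w))) (m≤n+m _ _)
    ... | no x≢w   | no y≢w   = contradiction (w , vw , (λ w≡x → x≢w (sym w≡x)) , λ w≡y → y≢w (sym w≡y)) none

  -- A walk all of whose vertices satisfy P; for P = λ _ → ⊤ the instance arguments are found
  -- automatically, so plain walks carry no proof terms.
  data WalkIn (P : Fin n → Set) : Fin n → Fin n → ℕ → Set where
    []  : ∀ {u} → {{P u}} → WalkIn P u u 0
    _∷_ : ∀ {u w v k} → {{P u}} → Adj G u w → WalkIn P w v k → WalkIn P u v (suc k)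

  _⇝[_]_ : Fin n → ℕ → Fin n → Set
  u ⇝[ k ] v = WalkIn (λ _ → ⊤) u v k

  fromWalk : ∀ {P u v} k (W : Walk G u v k) → (∀ i → P (Walk.p W i)) → WalkIn P u v k
  fromWalk {P} {u} zero W onP =
    subst (λ x → WalkIn P u x 0) (trans (sym (Walk.start W)) (Walk.end W)) ([] {{subst P (Walk.start W) (onP zero)}})
  fromWalk {P} (suc k) W onP =
    _∷_ {{subst P (Walk.start W) (onP zero)}}
        (subst (λ x → Adj G x (Walk.p W (suc zero))) (Walk.start W) (Walk.step W zero))
        (fromWalk k tail (λ i → onP (suc i)))
    where
    tail : Walk G (Walk.p W (suc zero)) _ k
    tail = record { p = λ i → Walk.p W (suc i) ; start = refl ; end = Walk.end W ; step = λ i → Walk.step W (suc i) }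

  toWalk : ∀ {u v k} → u ⇝[ k ] v → Walk G u v k
  toWalk {u} [] = record { p = λ _ → u ; start = refl ; end = refl ; step = λ () }
  toWalk {u} {k = suc k} (uw ∷ W) = record { p = p ; start = refl ; end = Walk.end tail ; step = step }
    where
    tail = toWalk W
    p : Fin (suc (suc k)) → Fin n
    p zero    = u
    p (suc i) = Walk.p tail i
    step : ∀ i → Adj G (p (inject₁ i)) (p (suc i))
    step zero    = subst (Adj G u) (sym (Walk.start tail)) uw
    step (suc i) = Walk.step tail i

  _++_ : ∀ {a b c k l} → a ⇝[ k ] b → b ⇝[ l ] c → a ⇝[ k + l ] c
  []       ++ W′ = W′
  (h ∷ W) ++ W′ = h ∷ (W ++ W′)

  _∷ʳ_ : ∀ {a b c k} → a ⇝[ k ] b → Adj G b c → a ⇝[ suc k ] c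
  []       ∷ʳ h′ = h′ ∷ []
  (h ∷ W) ∷ʳ h′ = h ∷ (W ∷ʳ h′)

  reverse : ∀ {a b k} → a ⇝[ k ] b → b ⇝[ k ] a
  reverse []       = []
  reverse (h ∷ W) = reverse W ∷ʳ Adj-sym h

  walk? : ∀ k u v → Dec (u ⇝[ k ] v)
  walk? zero    u v = map′ (λ { refl → [] }) (λ { [] → refl }) (u ≟ᶠ v)
  walk? (suc k) u v = map′ (λ (w , uw , W) → uw ∷ W) (λ { (uw ∷ W) → _ , uw , W })
                           (any? λ w → Adj? u w ×-dec walk? k w v)

  IsDist : Fin n → Fin n → ℕ → Set
  IsDist u v d = u ⇝[ d ] v × (∀ m → m < d → ¬ u ⇝[ m ] v)

  fromDist : ∀ {u v d} → Dist G u v d → IsDist u v d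
  fromDist {d = d} (W , minimal) = fromWalk d W (λ _ → tt) , λ m m<d W′ → minimal m m<d (toWalk W′)

  toDist : ∀ {u v d} → IsDist u v d → Dist G u v d
  toDist (W , minimal) = toWalk W , λ m m<d W′ → minimal m m<d (fromWalk m W′ (λ _ → tt))

  IsDist-sym : ∀ {u v d} → IsDist u v d → IsDist v u d
  IsDist-sym (W , minimal) = reverse W , λ m m<d W′ → minimal m m<d (reverse W′)

  IsDist⇒≢ : ∀ {u v d} → IsDist u v (suc d) → u ≢ v
  IsDist⇒≢ (_ , minimal) refl = minimal 0 (s≤s z≤n) []

  IsDist-injective : ∀ {u w v d d′} → IsDist u v d → IsDist w v d′ → d′ < d → u ≢ w
  IsDist-injective (_ , minimal) (W , _) d′<d refl = minimal _ d′<d W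

  shortest : ∀ {u v} k → u ⇝[ k ] v → ∃ (IsDist u v)
  shortest {u} {v} = <-rec (λ k → u ⇝[ k ] v → ∃ (IsDist u v)) λ k rec W →
    case anyUpTo? (λ m → walk? m u v) k of λ where
      (yes (m , m<k , W′)) → rec m<k W′
      (no none)             → k , W , λ m m<k W′ → none (m , m<k , W′)

  geodesic-step : ∀ {u v d} → IsDist u v (suc d) → ∃[ w ] Adj G u w × IsDist w v d
  geodesic-step (uw ∷ W , minimal) = _ , uw , W , λ m m<d W′ → minimal (suc m) (s≤s m<d) (uw ∷ W′)

  IsDist-split₃ : ∀ {u v d} → IsDist u v (3 + d) → ∃[ w ] IsDist u w 3 × IsDist w v d
  IsDist-split₃ {d = d} (h₁ ∷ h₂ ∷ h₃ ∷ W , minimal) =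
    _ , (h₁ ∷ h₂ ∷ h₃ ∷ [] , λ m m<3 W′ → minimal (m + d) (+-monoˡ-< d m<3) (W′ ++ W))
      , (W , λ m m<d W′ → minimal (3 + m) (+-monoʳ-< 3 m<d) (h₁ ∷ h₂ ∷ h₃ ∷ W′))

  _~_ : Fin n → Fin n → Set
  u ~ v = Star (D3Adj G) u v

  ~-sym : ∀ {u v} → u ~ v → v ~ u
  ~-sym = Star.reverse (λ uv → toDist (IsDist-sym (fromDist uv)))

  descend : ∀ j {u v d} → IsDist u v (d + j * 3) → ∃[ w ] u ~ w × IsDist w v d
  descend zero    {d = d} D = _ , ε , subst (IsDist _ _) (+-identityʳ d) D
  descend (suc j) {d = d} D with IsDist-split₃ (subst (IsDist _ _) (x∙yz≈y∙xz d 3 (j * 3)) D)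
  ... | w , uw , Dw with descend j Dw
  ...   | w′ , ww′ , Dw′ = w′ , toDist uw ◅ ww′ , Dw′

  cycle : ∀ {m} (vs : Vec (Fin n) (suc m)) → 2 ≤ m → Unique vs
        → (∀ i → Adj G (lookup vs (inject₁ i)) (lookup vs (suc i)))
        → Adj G (lookup vs (fromℕ m)) (lookup vs zero) → Cycle G m
  cycle vs 2≤m distinct step close = record
    { c = lookup vs ; inj = lookup-injective distinct _ _ ; long = 2≤m ; step = step ; close = close }

  walk⇒non-leaf-neighbour : ∀ {P x v k} → Decidable P → WalkIn P x v k → v ≢ x → 2 ≤ deg G v
                          → ∃[ t ] Adj G x t × P t × 2 ≤ deg G t
  walk⇒non-leaf-neighbour {P} {x} P? W v≢x 2≤deg with any? (λ t → Adj? x t ×-dec P? t ×-dec 2 ≤? deg G t)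
  ... | yes found = found
  ... | no none   = contradiction (trapped W (inj₁ refl)) [ v≢x , (λ (_ , deg<2) → <⇒≱ deg<2 2≤deg) ]′
    where
    Trapped : Fin n → Set
    Trapped a = a ≡ x ⊎ (Adj G x a × deg G a < 2)
    first : ∀ {a b k} → WalkIn P a b k → P a
    first ([] {{pa}})      = pa
    first (_∷_ {{pa}} _ _) = pa
    step : ∀ {a w} → Trapped a → Adj G a w → P w → Trapped w
    step (inj₁ refl) xw pw = inj₂ (xw , ≰⇒> λ 2≤ → none (_ , xw , pw , 2≤))
    step {w = w} (inj₂ (xa , deg<2)) aw _ with w ≟ᶠ x
    ... | yes w≡x = inj₁ w≡x
    ... | no w≢x  = contradiction (≢-neighbours⇒2≤deg (Adj-sym xa) aw (λ x≡w → w≢x (sym x≡w))) (<⇒≱ deg<2)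
    trapped : ∀ {a b k} → WalkIn P a b k → Trapped a → Trapped b
    trapped []       t = t
    trapped (aw ∷ W) t = trapped W (step t aw (first W))

module Pentagon {n : ℕ} {G : SimpleGraph n} (C : Cycle G 4)
                (C-unique : ∀ m (C′ : Cycle G m) → SameCycle G C C′) where

  open Graph G

  c : Fin 5 → Fin n
  c = Cycle.c C

  x₁ x₂ x₃ x₄ x₅ : Fin n
  x₁ = c zero
  x₂ = c (suc zero)
  x₃ = c (suc (suc zero))
  x₄ = c (suc (suc (suc zero)))
  x₅ = c (suc (suc (suc (suc zero))))

  x₁x₂ : Adj G x₁ x₂
  x₁x₂ = Cycle.step C zero
  x₂x₃ : Adj G x₂ x₃
  x₂x₃ = Cycle.step C (suc zero)
  x₃x₄ : Adj G x₃ x₄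
  x₃x₄ = Cycle.step C (suc (suc zero))
  x₄x₅ : Adj G x₄ x₅
  x₄x₅ = Cycle.step C (suc (suc (suc zero)))
  x₅x₁ : Adj G x₅ x₁
  x₅x₁ = Cycle.close C

  c-≢ : ∀ {i j} → i ≢ j → c i ≢ c j
  c-≢ i≢j ci≡cj = i≢j (Cycle.inj C ci≡cj)

  OnC : Fin n → Set
  OnC v = ∃[ i ] v ≡ c i

  Avoided : Fin n → Set
  Avoided v = v ≡ x₂ ⊎ v ≡ x₃ ⊎ v ≡ x₄ ⊎ v ≡ x₅

  Avoided? : Decidable Avoided
  Avoided? v = v ≟ᶠ x₂ ⊎-dec v ≟ᶠ x₃ ⊎-dec v ≟ᶠ x₄ ⊎-dec v ≟ᶠ x₅

  off-C : ∀ {v} → v ≢ x₁ → ¬ Avoided v → ¬ OnC v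
  off-C v≢x₁ _    (zero , v≡)                         = v≢x₁ v≡
  off-C _    ¬avd (suc zero , v≡)                     = ¬avd (inj₁ v≡)
  off-C _    ¬avd (suc (suc zero) , v≡)               = ¬avd (inj₂ (inj₁ v≡))
  off-C _    ¬avd (suc (suc (suc zero)) , v≡)         = ¬avd (inj₂ (inj₂ (inj₁ v≡)))
  off-C _    ¬avd (suc (suc (suc (suc zero))) , v≡)   = ¬avd (inj₂ (inj₂ (inj₂ v≡)))

  edge-on-cycle : ∀ {m} (C′ : Cycle G m) {a b} → CycleEdge G C′ a b → ∃[ j ] a ≡ Cycle.c C′ j
  edge-on-cycle C′ (inj₁ (i , inj₁ (refl , _)))  = inject₁ i , refl
  edge-on-cycle C′ (inj₁ (i , inj₂ (_ , refl)))  = suc i , refl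
  edge-on-cycle C′ (inj₂ (inj₁ (refl , _)))      = fromℕ _ , refl
  edge-on-cycle C′ (inj₂ (inj₂ (_ , refl)))      = zero , refl

  C⊆cycle : ∀ {m} (C′ : Cycle G m) (i : Fin 5) → ∃[ j ] c i ≡ Cycle.c C′ j
  C⊆cycle C′ i = edge-on-cycle C′ (proj₁ (C-unique _ C′ (c i) _) (proj₂ (edge-from i)))
    where
    edge-from : ∀ i → ∃[ b ] CycleEdge G C (c i) b
    edge-from zero                          = _ , inj₁ (zero , inj₁ (refl , refl))
    edge-from (suc zero)                    = _ , inj₁ (suc zero , inj₁ (refl , refl))
    edge-from (suc (suc zero))              = _ , inj₁ (suc (suc zero) , inj₁ (refl , refl))
    edge-from (suc (suc (suc zero)))        = _ , inj₁ (suc (suc (suc zero)) , inj₁ (refl , refl))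
    edge-from (suc (suc (suc (suc zero))))  = _ , inj₂ (inj₁ (refl , refl))

  cycle⊆C : ∀ {m} (C′ : Cycle G m) (j : Fin m) → OnC (Cycle.c C′ (inject₁ j))
  cycle⊆C C′ j = edge-on-cycle C (proj₂ (C-unique _ C′ _ _) (inj₁ (j , inj₁ (refl , refl))))

  cycle⇒4≤length : ∀ {m} → Cycle G m → 4 ≤ m
  cycle⇒4≤length C′ = ≮⇒≥ λ m<4 →
    let i , j , i<j , same = pigeonhole (s≤s m<4) (λ i → proj₁ (C⊆cycle C′ i))
    in  <⇒≢ᶠ i<j (Cycle.inj C (trans (proj₂ (C⊆cycle C′ i))
                                     (trans (cong (Cycle.c C′) same) (sym (proj₂ (C⊆cycle C′ j))))))

  no-triangle : ∀ {a b d} → Adj G a b → Adj G b d → Adj G d a → ⊥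
  no-triangle ab bd da = contradiction (cycle⇒4≤length triangle) λ { (s≤s (s≤s ())) }
    where
    triangle : Cycle G 2
    triangle = cycle (_ ∷ _ ∷ _ ∷ [])  (s≤s (s≤s z≤n))
      ((Adj⇒≢ ab ∷ ≢-sym (Adj⇒≢ da) ∷ []) ∷ (Adj⇒≢ bd ∷ []) ∷ [] ∷ [])
      (λ { zero → ab ; (suc zero) → bd }) da

  no-square : ∀ {a b d e} → Adj G a b → Adj G b d → Adj G d e → Adj G e a → a ≢ d → b ≢ e → ⊥
  no-square ab bd de ea a≢d b≢e = contradiction (cycle⇒4≤length square) λ { (s≤s (s≤s (s≤s ()))) }
    where
    square : Cycle G 3
    square = cycle (_ ∷ _ ∷ _ ∷ _ ∷ []) (s≤s (s≤s z≤n))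
      ((Adj⇒≢ ab ∷ a≢d ∷ ≢-sym (Adj⇒≢ ea) ∷ []) ∷ (Adj⇒≢ bd ∷ b≢e ∷ []) ∷ (Adj⇒≢ de ∷ []) ∷ [] ∷ [])
      (λ { zero → ab ; (suc zero) → bd ; (suc (suc zero)) → de }) ea

  pentagon⊆C : ∀ {a b d e w} → Adj G a b → Adj G b d → Adj G d e → Adj G e w → Adj G w a
             → a ≢ d → a ≢ e → b ≢ e → b ≢ w → d ≢ w → OnC a × OnC b × OnC d × OnC e
  pentagon⊆C ab bd de ew wa a≢d a≢e b≢e b≢w d≢w =
    cycle⊆C pentagon zero , cycle⊆C pentagon (suc zero) , cycle⊆C pentagon (suc (suc zero))
      , cycle⊆C pentagon (suc (suc (suc zero)))
    where
    pentagon : Cycle G 4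
    pentagon = cycle (_ ∷ _ ∷ _ ∷ _ ∷ _ ∷ []) (s≤s (s≤s z≤n))
      (  (Adj⇒≢ ab ∷ a≢d ∷ a≢e ∷ ≢-sym (Adj⇒≢ wa) ∷ [])
       ∷ (Adj⇒≢ bd ∷ b≢e ∷ b≢w ∷ []) ∷ (Adj⇒≢ de ∷ d≢w ∷ []) ∷ (Adj⇒≢ ew ∷ []) ∷ [] ∷ [])
      (λ { zero → ab ; (suc zero) → bd ; (suc (suc zero)) → de ; (suc (suc (suc zero))) → ew }) wa

  geodesic₃ : ∀ {a b d e} → Adj G a b → Adj G b d → Adj G d e → a ≢ d → b ≢ e
            → ¬ (OnC a × OnC b × OnC d × OnC e) → D3Adj G a e
  geodesic₃ {a} {b} {d} {e} ab bd de a≢d b≢e off = toDist (ab ∷ bd ∷ de ∷ [] , shorter)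
    where
    a≢e : a ≢ e
    a≢e refl = no-triangle ab bd de
    shorter : ∀ m → m < 3 → ¬ a ⇝[ m ] e
    shorter 0 _ []                  = a≢e refl
    shorter 1 _ (ae ∷ [])           = no-square ab bd de (Adj-sym ae) a≢d b≢e
    shorter 2 _ (_∷_ {w = w} aw (we ∷ [])) with w ≟ᶠ b | w ≟ᶠ d
    ... | yes refl | _        = no-triangle bd de (Adj-sym we)
    ... | _        | yes refl = no-triangle ab bd (Adj-sym aw)
    ... | no w≢b   | no w≢d   =
      off (pentagon⊆C ab bd de (Adj-sym we) (Adj-sym aw) a≢d a≢e b≢e (≢-sym w≢b) (≢-sym w≢d))
    shorter (suc (suc (suc _))) (s≤s (s≤s (s≤s ()))) _

  x₁-neighbour-off-C : ∀ {z} → Adj G x₁ z → z ≢ x₂ → z ≢ x₅ → ¬ OnC z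
  x₁-neighbour-off-C x₁z _   _   (zero , refl)                       = Adj⇒≢ x₁z refl
  x₁-neighbour-off-C _   z≢x₂ _   (suc zero , z≡)                    = z≢x₂ z≡
  x₁-neighbour-off-C x₁z _   _   (suc (suc zero) , refl)             = no-triangle x₁x₂ x₂x₃ (Adj-sym x₁z)
  x₁-neighbour-off-C x₁z _   _   (suc (suc (suc zero)) , refl)       = no-triangle x₁z x₄x₅ x₅x₁
  x₁-neighbour-off-C _   _   z≢x₅ (suc (suc (suc (suc zero))) , z≡) = z≢x₅ z≡

  x₂-neighbour-off-C : ∀ {z} → Adj G x₂ z → z ≢ x₁ → z ≢ x₃ → ¬ OnC z
  x₂-neighbour-off-C _   z≢x₁ _   (zero , z≡)                         = z≢x₁ z≡
  x₂-neighbour-off-C x₂z _   _   (suc zero , refl)                    = Adj⇒≢ x₂z refl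
  x₂-neighbour-off-C _   _   z≢x₃ (suc (suc zero) , z≡)               = z≢x₃ z≡
  x₂-neighbour-off-C x₂z _   _   (suc (suc (suc zero)) , refl)        = no-triangle x₂x₃ x₃x₄ (Adj-sym x₂z)
  x₂-neighbour-off-C x₂z _   _   (suc (suc (suc (suc zero))) , refl)  = no-triangle x₅x₁ x₁x₂ x₂z

  x₅-neighbour-off-C : ∀ {z} → Adj G x₅ z → z ≢ x₁ → z ≢ x₄ → ¬ OnC z
  x₅-neighbour-off-C _   z≢x₁ _   (zero , z≡)                         = z≢x₁ z≡
  x₅-neighbour-off-C x₅z _   _   (suc zero , refl)                    = no-triangle x₅x₁ x₁x₂ (Adj-sym x₅z)
  x₅-neighbour-off-C x₅z _   _   (suc (suc zero) , refl)              = no-triangle x₃x₄ x₄x₅ x₅z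
  x₅-neighbour-off-C _   _   z≢x₄ (suc (suc (suc zero)) , z≡)         = z≢x₄ z≡
  x₅-neighbour-off-C x₅z _   _   (suc (suc (suc (suc zero))) , refl)  = Adj⇒≢ x₅z refl

  inner-link : ∀ {u p q} → InnerNode G u → ¬ OnC u → Adj G u p → Adj G p q → q ≢ u → p ~ q
  inner-link {u} {p} (3≤deg , w₁ , w₂ , w₁≢w₂ , uw₁ , uw₂ , deg-w₁ , deg-w₂) u-off up pq q≢u =
    let a , ua , a≢p , 2≤deg-a = branch
        a′ , aa′ , a′≢u        = neighbour-≢ 2≤deg-a u
        b , ub , b≢a , b≢p     = neighbour-≢₂ 3≤deg a p
    in  geodesic₃ (Adj-sym up) ua aa′ (≢-sym a≢p) (≢-sym a′≢u) (λ (_ , on-u , _) → u-off on-u)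
      ◅ geodesic₃ (Adj-sym aa′) (Adj-sym ua) ub a′≢u (≢-sym b≢a) (λ (_ , _ , on-u , _) → u-off on-u)
      ◅ geodesic₃ (Adj-sym ub) up pq b≢p (≢-sym q≢u) (λ (_ , on-u , _) → u-off on-u)
      ◅ ε
    where
    branch : ∃[ a ] Adj G u a × a ≢ p × 2 ≤ deg G a
    branch with w₁ ≟ᶠ p
    ... | yes refl = w₂ , uw₂ , (λ w₂≡w₁ → w₁≢w₂ (sym w₂≡w₁)) , deg-w₂
    ... | no w₁≢p  = w₁ , uw₁ , w₁≢p , deg-w₁

module PentagonBranch {n : ℕ} {G : SimpleGraph n} (C : Cycle G 4)
                      (C-unique : ∀ m (C′ : Cycle G m) → SameCycle G C C′)
                      (3≤deg-x₂ : 3 ≤ deg G (Cycle.c C (suc zero)))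
                      {t₀ : Fin n} (x₁t₀ : Adj G (Cycle.c C zero) t₀)
                      (t₀-off : ¬ Pentagon.OnC C C-unique t₀) (2≤deg-t₀ : 2 ≤ deg G t₀) where

  open Graph G
  open Pentagon C C-unique

  off-C-x₁-neighbour~x₃ : ∀ {t} → Adj G x₁ t → ¬ OnC t → t ~ x₃
  off-C-x₁-neighbour~x₃ x₁t t-off =
    geodesic₃ (Adj-sym x₁t) x₁x₂ x₂x₃ (λ t≡x₂ → t-off (_ , t≡x₂)) (c-≢ λ ()) (λ (on-t , _) → t-off on-t) ◅ ε

  t₀~x₃ : t₀ ~ x₃
  t₀~x₃ = off-C-x₁-neighbour~x₃ x₁t₀ t₀-off

  x₄~x₃ : x₄ ~ x₃
  x₄~x₃ = geodesic₃ x₄x₅ x₅x₁ x₁t₀ (c-≢ λ ()) (λ x₅≡t₀ → t₀-off (_ , sym x₅≡t₀)) (λ (_ , _ , _ , on) → t₀-off on)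
        ◅ t₀~x₃

  x₅~x₃ : x₅ ~ x₃
  x₅~x₃ =
    let s , x₂s , s≢x₁ , s≢x₃ = neighbour-≢₂ 3≤deg-x₂ x₁ x₃
        s-off                 = x₂-neighbour-off-C x₂s s≢x₁ s≢x₃
    in  geodesic₃ x₅x₁ x₁x₂ x₂s (c-≢ λ ()) (λ x₁≡s → s-off (_ , sym x₁≡s)) (λ (_ , _ , _ , on) → s-off on)
      ◅ geodesic₃ (Adj-sym x₂s) (Adj-sym x₁x₂) x₁t₀ s≢x₁ (λ x₂≡t₀ → t₀-off (_ , sym x₂≡t₀)) (λ (on , _) → s-off on)
      ◅ t₀~x₃

  x₂~x₃ : x₂ ~ x₃
  x₂~x₃ =
    let y , t₀y , y≢x₁ = neighbour-≢ 2≤deg-t₀ x₁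
    in  geodesic₃ (Adj-sym x₁x₂) x₁t₀ t₀y (λ x₂≡t₀ → t₀-off (_ , sym x₂≡t₀)) (≢-sym y≢x₁)
                  (λ (_ , _ , on , _) → t₀-off on)
      ◅ geodesic₃ (Adj-sym t₀y) (Adj-sym x₁t₀) (Adj-sym x₅x₁) y≢x₁ (λ t₀≡x₅ → t₀-off (_ , t₀≡x₅))
                  (λ (_ , on , _) → t₀-off on)
      ◅ x₅~x₃

  x₁-neighbour~x₃ : ∀ {w} → Adj G x₁ w → w ~ x₃
  x₁-neighbour~x₃ {w} x₁w with w ≟ᶠ x₂ | w ≟ᶠ x₅
  ... | yes refl | _        = x₂~x₃
  ... | no _     | yes refl = x₅~x₃
  ... | no w≢x₂  | no w≢x₅  = off-C-x₁-neighbour~x₃ x₁w (x₁-neighbour-off-C x₁w w≢x₂ w≢x₅)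

  x₁-second-neighbour~x₃ : ∀ {m z} → Adj G x₁ m → Adj G m z → z ≢ x₁ → z ~ x₃
  x₁-second-neighbour~x₃ {m} {z} x₁m mz z≢x₁ with m ≟ᶠ x₂ | m ≟ᶠ x₅
  ... | yes refl | _ with z ≟ᶠ x₃
  ...   | yes refl = ε
  ...   | no z≢x₃  = geodesic₃ (Adj-sym mz) (Adj-sym x₁x₂) x₁t₀ z≢x₁ (λ x₂≡t₀ → t₀-off (_ , sym x₂≡t₀))
                               (λ (on , _) → x₂-neighbour-off-C mz z≢x₁ z≢x₃ on)
                   ◅ t₀~x₃
  x₁-second-neighbour~x₃ {m} {z} x₁m mz z≢x₁ | no _ | yes refl with z ≟ᶠ x₄
  ...   | yes refl = x₄~x₃
  ...   | no z≢x₄  = geodesic₃ (Adj-sym mz) x₅x₁ x₁t₀ z≢x₁ (λ x₅≡t₀ → t₀-off (_ , sym x₅≡t₀))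
                               (λ (on , _) → x₅-neighbour-off-C mz z≢x₁ z≢x₄ on)
                   ◅ t₀~x₃
  x₁-second-neighbour~x₃ {m} {z} x₁m mz z≢x₁ | no m≢x₂ | no m≢x₅ =
    geodesic₃ (Adj-sym mz) (Adj-sym x₁m) (Adj-sym x₅x₁) z≢x₁ m≢x₅
              (λ (_ , on , _) → x₁-neighbour-off-C x₁m m≢x₂ m≢x₅ on)
    ◅ x₅~x₃

  dist₀~x₁ : ∀ j {v} → IsDist v x₁ (j * 3) → v ~ x₁
  dist₀~x₁ j D with descend j D
  ... | _ , v~w , ([] , _) = v~w

  dist₁~x₃ : ∀ j {v} → IsDist v x₁ (1 + j * 3) → v ~ x₃
  dist₁~x₃ j D with descend j D
  ... | _ , v~w , (wx₁ ∷ [] , _) = v~w ◅◅ x₁-neighbour~x₃ (Adj-sym wx₁)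

  dist₂~x₃ : ∀ j {v} → IsDist v x₁ (2 + j * 3) → v ~ x₃
  dist₂~x₃ j D with descend j D
  ... | _ , v~w , Dw@(wm ∷ mx₁ ∷ [] , _) = v~w ◅◅ x₁-second-neighbour~x₃ (Adj-sym mx₁) (Adj-sym wm) (IsDist⇒≢ Dw)

  x₁~x₃ : ∀ {u} → InnerNode G u → ¬ OnC u
        → ∀ j → IsDist u x₁ (1 + j * 3) ⊎ IsDist u x₁ (2 + j * 3) → x₁ ~ x₃
  x₁~x₃ inner u-off zero (inj₁ (ux₁ ∷ [] , _)) =
    inner-link inner u-off ux₁ x₁x₂ (λ x₂≡u → u-off (_ , sym x₂≡u)) ◅◅ x₂~x₃
  x₁~x₃ inner u-off (suc j) (inj₁ D) =
    let p , up , Dp = geodesic-step D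
        q , pq , Dq = geodesic-step Dp
        q≢u = ≢-sym (IsDist-injective D Dq (+-monoˡ-< (j * 3) (s≤s (s≤s (s≤s z≤n)))))
    in  ~-sym (dist₀~x₁ (suc j) Dp) ◅◅ inner-link inner u-off up pq q≢u ◅◅ dist₂~x₃ j Dq
  x₁~x₃ inner u-off j (inj₂ D) =
    let p , up , Dp = geodesic-step D
        q , pq , Dq = geodesic-step Dp
        q≢u = ≢-sym (IsDist-injective D Dq (+-monoˡ-< (j * 3) (s≤s z≤n)))
    in  ~-sym (dist₀~x₁ j Dq) ◅◅ ~-sym (inner-link inner u-off up pq q≢u) ◅◅ dist₁~x₃ j Dp

  all~x₃ : (∀ v → ∃[ k ] Walk G v x₁ k) → x₁ ~ x₃ → ∀ v → v ~ x₃
  all~x₃ connected x₁~x₃ v =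
    let L , D = shortest _ (fromWalk _ (proj₂ (connected v)) (λ _ → tt))
    in  residue (L % 3) (L / 3) (m%n<n L 3) (subst (IsDist v x₁) (m≡m%n+[m/n]*n L 3) D)
    where
    residue : ∀ r j {w} → r < 3 → IsDist w x₁ (r + j * 3) → w ~ x₃
    residue 0 j _ D = dist₀~x₁ j D ◅◅ x₁~x₃
    residue 1 j _ D = dist₁~x₃ j D
    residue 2 j _ D = dist₂~x₃ j D
    residue (suc (suc (suc _))) _ (s≤s (s≤s (s≤s ()))) _

lemma2p12 : ∀ {n} (G : SimpleGraph n) → Unicyclic G → (C : Cycle G 4)
    → 3 ≤ deg G (Cycle.c C zero) → 3 ≤ deg G (Cycle.c C (suc zero))
    → (u : Fin n) → InnerNode G u
    → InComponentAvoiding G (λ v → (v ≡ Cycle.c C (suc zero)) ⊎ (v ≡ Cycle.c C (suc (suc zero)))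
        ⊎ (v ≡ Cycle.c C (suc (suc (suc zero)))) ⊎ (v ≡ Cycle.c C (suc (suc (suc (suc zero))))))
        (Cycle.c C zero) u
    → (k : ℕ) → Dist G u (Cycle.c C zero) (3 * k + 1) ⊎ Dist G u (Cycle.c C zero) (3 * k + 2)
    → D3Connected G
-- deg(x₁) ≥ 3 is not needed: the branch at x₁ containing u already supplies a third neighbour t₀.
lemma2p12 G (connected , _ , unique) C _ 3≤deg-x₂ u inner (K , W , avoids) k u-x₁ a b =
  every a ◅◅ ~-sym (every b)
  where
  C-unique : ∀ m (C′ : Cycle G m) → SameCycle G C C′
  C-unique m C′ = unique 4 m C C′

  open Graph G
  open Pentagon C C-unique

  residue-first : ∀ r → 3 * k + r ≡ r + k * 3
  residue-first r = trans (+-comm (3 * k) r) (cong (r +_) (*-comm 3 k))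

  dist-u : IsDist u x₁ (1 + k * 3) ⊎ IsDist u x₁ (2 + k * 3)
  dist-u = Sum.map (subst (IsDist u x₁) (residue-first 1) ∘ fromDist)
                   (subst (IsDist u x₁) (residue-first 2) ∘ fromDist) u-x₁

  u≢x₁ : u ≢ x₁
  u≢x₁ = [ IsDist⇒≢ , IsDist⇒≢ ]′ dist-u

  u-off : ¬ OnC u
  u-off = off-C u≢x₁ (subst (λ v → ¬ Avoided v) (Walk.end W) (avoids (fromℕ K)))

  every : ∀ v → v ~ x₃
  every with t₀ , x₁t₀ , t₀-avoids , 2≤deg-t₀ ← walk⇒non-leaf-neighbour (¬? ∘ Avoided?) (fromWalk K W avoids) u≢x₁
                                                      (≤-trans (n≤1+n 2) (proj₁ inner))
    = let open PentagonBranch C C-unique 3≤deg-x₂ x₁t₀ (off-C (≢-sym (Adj⇒≢ x₁t₀)) t₀-avoids) 2≤deg-t₀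
      in  all~x₃ (λ v → connected v x₁) (x₁~x₃ inner u-off k dist-u)
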